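{- Let $t$ be a term and $v$ a value with $t \to_{\bar{\mathsf{sh}}}^* v$. Then for any type derivation $\pi$ with conclusion $\vdash t \colon \mathbf{0}$ (empty environment, empty multiset type), $\mathrm{leng}_{\beta_v}(t) = |\pi|$.
   Context: Terms: $t ::= x \mid \lambda x.t \mid tu$ up to $\alpha$-conversion; values are variables and abstractions. Balanced contexts: $B ::= [\cdot] \mid (\lambda x.B)t \mid Bt \mid tB$. Root rules: $(\lambda x.t)v \mapsto_{\beta_v} t\{v/x\}$ ($v$ value); $(\lambda x.t)us \mapsto_{\sigma_1} (\lambda x.ts)u$ if $x\notin\mathrm{fv}(s)$; $v((\lambda x.s)u) \mapsto_{\sigma_3} (\lambda x.vs)u$ if $v$ value and $x \notin \mathrm{fv}(v)$. $\to_{\bar{\beta}_v}$, $\to_{\bar\sigma}$ are the closures of $\mapsto_{\beta_v}$ and of $\mapsto_{\sigma_1}\cup\mapsto_{\sigma_3}$ under balanced contexts, and $\to_{\bar{\mathsf{sh}}} = \to_{\bar\beta_v}\cup\to_{\bar\sigma}$. $\mathrm{leng}_{\beta_v}(t)$ is the number of $\bar\beta_v$-steps in any reduction sequence from $t$ to its $\bar{\mathsf{sh}}$-normal form (this number is independent of the sequence), and $\infty$ if $t$ is not $\bar{\mathsf{sh}}$-normalizable. Types: negative $N ::= P\multimap Q$; positive $P,Q ::= [N_1,\dots,N_n]$ finite multisets ($n\ge0$), $\mathbf{0}$ the empty multiset. Environments: maps from variables to positive types, $\mathbf{0}$ almost everywhere; $\uplus$ pointwise multiset sum; $\vdash t\colon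 P$ means the environment is everywhere $\mathbf{0}$. Rules: (ax) $x\colon P\vdash x\colon P$; (@) from $\Gamma\vdash t\colon[P\multimap Q]$ and $\Gamma'\vdash u\colon P$ infer $\Gamma\uplus\Gamma'\vdash tu\colon Q$; ($\lambda$) for $n\ge0$, from $\Gamma_i,x\colon P_i\vdash t\colon Q_i$ ($1\le i\le n$) infer $\biguplus_i\Gamma_i\vdash\lambda x.t\colon[P_1\multimap Q_1,\dots,P_n\multimap Q_n]$. The size $|\pi|$ of a derivation is its number of (@) rules. -}

module Defs where

open import Data.Nat using (ℕ; zero; suc; _+_)
open import Data.Fin using (Fin; zero; suc)
open import Data.List using (List; []; _∷_; _++_)
open import Data.Vec using (Vec; []; _∷_; replicate; zipWith; _[_]≔_)
open import Data.Product using (Σ; ∃; _×_; _,_)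
open import Relation.Nullary using (¬_)
open import Relation.Binary.PropositionalEquality using (_≡_)
open import Relation.Binary.Construct.Closure.ReflexiveTransitive using (Star)
import Data.List.Relation.Binary.Permutation.Homogeneous as Perm
import Data.Vec.Relation.Binary.Pointwise.Inductive as VPW

-- Terms: well-scoped de Bruijn terms (α-equivalence classes).
-- Term n = terms whose free variables are among 0 … n-1.

infixl 7 _·_
data Term (n : ℕ) : Set where
  var : Fin n → Term n
  ƛ   : Term (suc n) → Term n
  _·_ : Term n → Term n → Term n

data Value {n : ℕ} : Term n → Set where
  v-var : (x : Fin n) → Value (var x)
  v-lam : (t : Term (suc n)) → Value (ƛ t)

ext : ∀ {n m} → (Fin n → Fin m) → Fin (suc n) → Fin (suc m)
ext ρ zero    = zero
ext ρ (suc x) = suc (ρ x)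

rename : ∀ {n m} → (Fin n → Fin m) → Term n → Term m
rename ρ (var x) = var (ρ x)
rename ρ (ƛ t)   = ƛ (rename (ext ρ) t)
rename ρ (t · u) = rename ρ t · rename ρ u

-- weakening: the image contains no occurrence of the new variable 0
shift : ∀ {n} → Term n → Term (suc n)
shift = rename suc

exts : ∀ {n m} → (Fin n → Term m) → Fin (suc n) → Term (suc m)
exts σ zero    = var zero
exts σ (suc x) = shift (σ x)

subst : ∀ {n m} → (Fin n → Term m) → Term n → Term m
subst σ (var x) = σ x
subst σ (ƛ t)   = ƛ (subst (exts σ) t)
subst σ (t · u) = subst σ t · subst σ u

_[_] : ∀ {n} → Term (suc n) → Term n → Term n
t [ v ] = subst σ t
  where
  σ : Fin (suc _) → Term _
  σ zero    = v
  σ (suc x) = var x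

-- Root rules
-- σ1 : (λx.t)u s ↦ (λx.ts)u      with x ∉ fv(s)  (s is weakened)
-- σ3 : v((λx.s)u) ↦ (λx.vs)u     with x ∉ fv(v)  (v is weakened)

data _↦βv_ {n : ℕ} : Term n → Term n → Set where
  βv : ∀ (t : Term (suc n)) (v : Term n) → Value v → (ƛ t · v) ↦βv (t [ v ])

data _↦σ_ {n : ℕ} : Term n → Term n → Set where
  σ₁ : ∀ (t : Term (suc n)) (u s : Term n) →
       (ƛ t · u · s) ↦σ (ƛ (t · shift s) · u)
  σ₃ : ∀ (v : Term n) (s : Term (suc n)) (u : Term n) → Value v →
       (v · (ƛ s · u)) ↦σ (ƛ (shift v · s) · u)

data Bal (R : ∀ {n} → Term n → Term n → Set) {n : ℕ} : Term n → Term n → Set where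
  root  : ∀ {t t'} → R t t' → Bal R t t'
  lamB  : ∀ {t t' : Term (suc n)} (u : Term n) → Bal R t t' → Bal R (ƛ t · u) (ƛ t' · u)
  appL  : ∀ {t t'} (u : Term n) → Bal R t t' → Bal R (t · u) (t' · u)
  appR  : ∀ {u u'} (t : Term n) → Bal R u u' → Bal R (t · u) (t · u')

_→β̄v_ : ∀ {n} → Term n → Term n → Set
_→β̄v_ = Bal _↦βv_

_→σ̄_ : ∀ {n} → Term n → Term n → Set
_→σ̄_ = Bal _↦σ_

-- →sh = →β̄v ∪ →σ̄ ; kept as a tagged union so βv-steps can be counted
data _→sh_ {n : ℕ} (t t' : Term n) : Set where
  stepβ : t →β̄v t' → t →sh t'
  stepσ : t →σ̄ t' → t →sh t'

_→sh*_ : ∀ {n} → Term n → Term n → Set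
_→sh*_ = Star _→sh_

ShNormal : ∀ {n} → Term n → Set
ShNormal t = ∀ t' → ¬ (t →sh t')

data _→sh*[_]_ {n : ℕ} : Term n → ℕ → Term n → Set where
  done  : ∀ {t} → t →sh*[ 0 ] t
  moreβ : ∀ {t t' s k} → t →β̄v t' → t' →sh*[ k ] s → t →sh*[ suc k ] s
  moreσ : ∀ {t t' s k} → t →σ̄ t' → t' →sh*[ k ] s → t →sh*[ k ] s

LengβvIs : ∀ {n} → Term n → ℕ → Set
LengβvIs t k =
  (Σ _ λ s → (t →sh*[ k ] s) × ShNormal s) ×
  (∀ s j → t →sh*[ j ] s → ShNormal s → j ≡ k)

-- Types: multisets are represented by lists, considered up to
-- (nested) permutation via _≈P_ below.

infixr 5 _⊸_
data Neg : Set where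
  _⊸_ : List Neg → List Neg → Neg

Pos : Set
Pos = List Neg

𝟎 : Pos
𝟎 = []

mutual
  data _≈N_ : Neg → Neg → Set where
    ⊸-cong : ∀ {P P' Q Q'} → P ≈P P' → Q ≈P Q' → (P ⊸ Q) ≈N (P' ⊸ Q')

  _≈P_ : Pos → Pos → Set
  _≈P_ = Perm.Permutation _≈N_

Env : ℕ → Set
Env n = Vec Pos n

𝟎ₑ : ∀ {n} → Env n
𝟎ₑ = replicate _ 𝟎

_⊎ₑ_ : ∀ {n} → Env n → Env n → Env n
_⊎ₑ_ = zipWith _++_

_≈E_ : ∀ {n} → Env n → Env n → Set
_≈E_ = VPW.Pointwise _≈P_

mutual
  data _⊢_∶_ {n : ℕ} : Env n → Term n → Pos → Set where
    ax   : ∀ (x : Fin n) (P : Pos) → (𝟎ₑ [ x ]≔ P) ⊢ var x ∶ P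
    app  : ∀ {Γ Γ' t u P Q} → Γ ⊢ t ∶ ((P ⊸ Q) ∷ []) → Γ' ⊢ u ∶ P →
           (Γ ⊎ₑ Γ') ⊢ t · u ∶ Q
    lam  : ∀ {Γ t Ps} → LamPremises Γ t Ps → Γ ⊢ ƛ t ∶ Ps
    -- multisets are identified up to permutation
    conv : ∀ {Γ Γ' t P P'} → Γ ≈E Γ' → P ≈P P' → Γ ⊢ t ∶ P → Γ' ⊢ t ∶ P'

  -- the n ≥ 0 premises Γᵢ , x : Pᵢ ⊢ t : Qᵢ of the (λ) rule,
  -- concluding ⨄ Γᵢ and [P₁ ⊸ Q₁, …, Pₙ ⊸ Qₙ]
  data LamPremises {n : ℕ} : Env n → Term (suc n) → Pos → Set where
    []  : ∀ {t} → LamPremises 𝟎ₑ t []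
    _∷_ : ∀ {Γ Δ t P Q Ps} → (P ∷ Γ) ⊢ t ∶ Q → LamPremises Δ t Ps →
          LamPremises (Γ ⊎ₑ Δ) t ((P ⊸ Q) ∷ Ps)

mutual
  size : ∀ {n} {Γ : Env n} {t P} → Γ ⊢ t ∶ P → ℕ
  size (ax x P)       = 0
  size (app π ρ)      = suc (size π + size ρ)
  size (lam ps)       = sizeL ps
  size (conv _ _ π)   = size π

  sizeL : ∀ {n} {Γ : Env n} {t Ps} → LamPremises Γ t Ps → ℕ
  sizeL []       = 0
  sizeL (π ∷ ps) = size π + sizeL ps

-- Typing is preserved along →sh, and the number of (@) rules drops by exactly one
-- at each β̄v-step and is unchanged at each σ̄-step.  For a βv-redex (λx.t)v the
-- argument is a value, and a derivation of a value at a multiset type P₁ ++ P₂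
-- splits into derivations at P₁ and at P₂ whose sizes add up; so substituting v
-- distributes its derivation over the occurrences of x without duplicating or
-- losing any (@) rule, and only the (@) of the redex disappears (a value used zero
-- times has type 𝟎 and size 0).  Finally, a sh-normal form typed with the empty
-- environment and type 𝟎 has size 0: a normal non-value is headed by a free
-- variable, which the environment would have to type, and a value typed at 𝟎 uses
-- no (@) rule.

module Submission where

open import Defs
open import Algebra.Bundles using (CommutativeMonoid)
import Algebra.Properties.CommutativeSemigroup as CommutativeSemigroupProperties
open import Data.Empty using (⊥-elim)
open import Data.Fin.Base using (Fin; zero; suc; punchIn; punchOut)
open import Data.Fin.Properties using (_≟_)
open import Data.List.Base using ([]; _∷_; _++_)
import Data.List.Relation.Binary.Permutation.Homogeneous as Perm
import Data.List.Relation.Binary.Permutation.Setoid.Properties as PermutationProperties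
open import Data.List.Relation.Binary.Pointwise.Base as ListPointwise using ([]; _∷_)
open import Data.Nat.Base using (ℕ; zero; suc; _+_)
open import Data.Nat.Properties using (+-commutativeSemigroup; +-assoc; +-suc; +-identityʳ)
open import Data.Product.Base using (Σ; ∃; _×_; _,_; proj₁; proj₂)
open import Data.Vec.Base using (Vec; []; _∷_; replicate; zipWith; lookup; insertAt; removeAt; _[_]≔_)
open import Data.Vec.Properties
  using (lookup-zipWith; lookup-replicate; lookup∘update; lookup∘update′; zipWith-replicate; []≔-lookup)
open import Data.Vec.Relation.Binary.Pointwise.Inductive as VecPointwise using (Pointwise; []; _∷_)
open import Level using (Level)
open import Relation.Binary.Bundles using (Setoid)
open import Relation.Binary.Construct.Closure.ReflexiveTransitive using (ε; _◅_)
open import Relation.Binary.Core using (Rel)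
open import Relation.Binary.Definitions using (Reflexive; Symmetric; Transitive)
open import Relation.Binary.PropositionalEquality as Eq using (_≡_; _≢_; _≗_; refl; sym; trans; cong; module ≡-Reasoning)
open import Relation.Nullary using (¬_; Dec; yes; no)

private
  variable
    a ℓ : Level
    A B C : Set a
    n : ℕ

mutual
  ≈N-refl : Reflexive _≈N_
  ≈N-refl {P ⊸ Q} = ⊸-cong ≈P-refl ≈P-refl

  ≈P-refl : Reflexive _≈P_
  ≈P-refl {[]}    = Perm.refl []
  ≈P-refl {N ∷ P} = Perm.prep ≈N-refl ≈P-refl

-- Not via Perm.sym ≈N-sym: the termination checker does not see through it.
mutual
  ≈N-sym : Symmetric _≈N_
  ≈N-sym (⊸-cong P≈P' Q≈Q') = ⊸-cong (≈P-sym P≈P') (≈P-sym Q≈Q')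

  ≈P-sym : Symmetric _≈P_
  ≈P-sym (Perm.refl Ps≋Qs)       = Perm.refl (≋N-sym Ps≋Qs)
  ≈P-sym (Perm.prep N≈M p)       = Perm.prep (≈N-sym N≈M) (≈P-sym p)
  ≈P-sym (Perm.swap N≈N' M≈M' p) = Perm.swap (≈N-sym M≈M') (≈N-sym N≈N') (≈P-sym p)
  ≈P-sym (Perm.trans p q)        = Perm.trans (≈P-sym q) (≈P-sym p)

  ≋N-sym : Symmetric (ListPointwise.Pointwise _≈N_)
  ≋N-sym []            = []
  ≋N-sym (N≈M ∷ Ps≋Qs) = ≈N-sym N≈M ∷ ≋N-sym Ps≋Qs

≈N-trans : Transitive _≈N_
≈N-trans (⊸-cong P≈P' Q≈Q') (⊸-cong P'≈P'' Q'≈Q'') =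
  ⊸-cong (Perm.trans P≈P' P'≈P'') (Perm.trans Q≈Q' Q'≈Q'')

≈N-setoid : Setoid _ _
≈N-setoid = record
  { Carrier       = Neg
  ; _≈_           = _≈N_
  ; isEquivalence = record { refl = ≈N-refl ; sym = ≈N-sym ; trans = ≈N-trans }
  }

open PermutationProperties ≈N-setoid using (¬x∷xs↭[]) renaming (++-commutativeMonoid to Pos-commutativeMonoid)

module Pos≈ = CommutativeMonoid Pos-commutativeMonoid

⊎ₑ-commutativeMonoid : ℕ → CommutativeMonoid _ _
⊎ₑ-commutativeMonoid n = record
  { Carrier             = Env n
  ; _≈_                 = _≈E_
  ; _∙_                 = _⊎ₑ_
  ; ε                   = 𝟎ₑ
  ; isCommutativeMonoid = record
    { isMonoid = record
      { isSemigroup = record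
        { isMagma = record
          { isEquivalence = VecPointwise.isEquivalence Pos≈.isEquivalence n
          ; ∙-cong        = VecPointwise.zipWith-cong Pos≈.∙-cong
          }
        ; assoc = VecPointwise.zipWith-assoc Pos≈.assoc
        }
      ; identity = VecPointwise.zipWith-identityˡ Pos≈.identityˡ
                 , VecPointwise.zipWith-identityʳ Pos≈.identityʳ
      }
    ; comm = VecPointwise.zipWith-comm Pos≈.comm
    }
  }

module Env≈ {n : ℕ} where
  open CommutativeMonoid (⊎ₑ-commutativeMonoid n) public
  open CommutativeSemigroupProperties commutativeSemigroup public

module ℕ+ = CommutativeSemigroupProperties +-commutativeSemigroup

removeAt-zipWith : ∀ (f : A → B → C) (xs : Vec A (suc n)) ys i →
  removeAt (zipWith f xs ys) i ≡ zipWith f (removeAt xs i) (removeAt ys i)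
removeAt-zipWith f (x ∷ xs)      (y ∷ ys)      zero    = refl
removeAt-zipWith f (x ∷ x' ∷ xs) (y ∷ y' ∷ ys) (suc i) =
  cong (f x y ∷_) (removeAt-zipWith f (x' ∷ xs) (y' ∷ ys) i)

zipWith-insertAt : ∀ (f : A → B → C) (xs : Vec A n) ys i x y →
  zipWith f (insertAt xs i x) (insertAt ys i y) ≡ insertAt (zipWith f xs ys) i (f x y)
zipWith-insertAt f xs        ys        zero    x y = refl
zipWith-insertAt f (x' ∷ xs) (y' ∷ ys) (suc i) x y = cong (f x' y' ∷_) (zipWith-insertAt f xs ys i x y)

removeAt-replicate : ∀ (i : Fin (suc n)) (x : A) → removeAt (replicate (suc n) x) i ≡ replicate n x
removeAt-replicate           zero    x = refl
removeAt-replicate {n = suc n} (suc i) x = cong (x ∷_) (removeAt-replicate i x)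

insertAt-replicate : ∀ (i : Fin (suc n)) (x : A) → insertAt (replicate n x) i x ≡ replicate (suc n) x
insertAt-replicate           zero    x = refl
insertAt-replicate {n = suc n} (suc i) x = cong (x ∷_) (insertAt-replicate i x)

insertAt-[]≔ : ∀ (xs : Vec A n) i j (x y : A) →
  insertAt (xs [ j ]≔ y) i x ≡ insertAt xs i x [ punchIn i j ]≔ y
insertAt-[]≔ xs       zero    j       x y = refl
insertAt-[]≔ (_ ∷ xs) (suc i) zero    x y = refl
insertAt-[]≔ (z ∷ xs) (suc i) (suc j) x y = cong (z ∷_) (insertAt-[]≔ xs i j x y)

removeAt-[]≔ : ∀ (xs : Vec A (suc n)) {i j} (i≢j : i ≢ j) y →
  removeAt (xs [ j ]≔ y) i ≡ removeAt xs i [ punchOut i≢j ]≔ y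
removeAt-[]≔ (x ∷ xs)     {zero}  {zero}        i≢j y = ⊥-elim (i≢j refl)
removeAt-[]≔ (x ∷ xs)     {zero}  {suc j}       i≢j y = refl
removeAt-[]≔ (x ∷ z ∷ xs) {suc i} {zero}        i≢j y = refl
removeAt-[]≔ (x ∷ z ∷ xs) {suc i} {suc zero}    i≢j y =
  cong (x ∷_) (removeAt-[]≔ (z ∷ xs) (λ i≡j → i≢j (cong suc i≡j)) y)
removeAt-[]≔ (x ∷ z ∷ xs) {suc i} {suc (suc j)} i≢j y =
  cong (x ∷_) (removeAt-[]≔ (z ∷ xs) (λ i≡j → i≢j (cong suc i≡j)) y)

removeAt-[]≔-same : ∀ (xs : Vec A (suc n)) i y → removeAt (xs [ i ]≔ y) i ≡ removeAt xs i
removeAt-[]≔-same (x ∷ xs)     zero          y = refl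
removeAt-[]≔-same (x ∷ z ∷ xs) (suc zero)    y = refl
removeAt-[]≔-same (x ∷ z ∷ xs) (suc (suc i)) y = cong (x ∷_) (removeAt-[]≔-same (z ∷ xs) (suc i) y)

zipWith-[]≔ : ∀ (f : A → B → C) (xs : Vec A n) ys i x y →
  zipWith f (xs [ i ]≔ x) (ys [ i ]≔ y) ≡ zipWith f xs ys [ i ]≔ f x y
zipWith-[]≔ f (_ ∷ xs)  (_ ∷ ys)  zero    x y = refl
zipWith-[]≔ f (x' ∷ xs) (y' ∷ ys) (suc i) x y = cong (f x' y' ∷_) (zipWith-[]≔ f xs ys i x y)

replicate-[]≔ : ∀ (i : Fin n) (x : A) → replicate n x [ i ]≔ x ≡ replicate n x
replicate-[]≔ {n = n} i x =
  trans (cong (replicate n x [ i ]≔_) (sym (lookup-replicate i x))) ([]≔-lookup (replicate n x) i)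

module _ {R : Rel A ℓ} where

  removeAt⁺ : ∀ {xs ys : Vec A (suc n)} i →
    Pointwise R xs ys → Pointwise R (removeAt xs i) (removeAt ys i)
  removeAt⁺ zero    (_ ∷ xs∼ys)           = xs∼ys
  removeAt⁺ (suc i) (x∼y ∷ z∼w ∷ xs∼ys) = x∼y ∷ removeAt⁺ i (z∼w ∷ xs∼ys)

  insertAt⁺ : ∀ {xs ys : Vec A n} {x y} i → R x y →
    Pointwise R xs ys → Pointwise R (insertAt xs i x) (insertAt ys i y)
  insertAt⁺ zero    x∼y xs∼ys           = x∼y ∷ xs∼ys
  insertAt⁺ (suc i) x∼y (z∼w ∷ xs∼ys) = z∼w ∷ insertAt⁺ i x∼y xs∼ys

-- removeAt (x ∷ xs) (suc i) only computes once xs is a cons.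
removeAt-suc : ∀ (x : A) (xs : Vec A (suc n)) i → removeAt (x ∷ xs) (suc i) ≡ x ∷ removeAt xs i
removeAt-suc x (y ∷ xs) i = refl

singleton-cong : ∀ (x : Fin n) {P Q} → P ≈P Q → (𝟎ₑ [ x ]≔ P) ≈E (𝟎ₑ [ x ]≔ Q)
singleton-cong zero    P≈Q = P≈Q ∷ Env≈.refl
singleton-cong (suc x) P≈Q = Pos≈.refl ∷ singleton-cong x P≈Q

singleton-++ : ∀ (x : Fin n) P Q → (𝟎ₑ [ x ]≔ (P ++ Q)) ≡ (𝟎ₑ [ x ]≔ P) ⊎ₑ (𝟎ₑ [ x ]≔ Q)
singleton-++ x P Q = begin
  𝟎ₑ [ x ]≔ (P ++ Q)                  ≡⟨ cong (_[ x ]≔ (P ++ Q)) (zipWith-replicate _++_ [] []) ⟨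
  (𝟎ₑ ⊎ₑ 𝟎ₑ) [ x ]≔ (P ++ Q)          ≡⟨ zipWith-[]≔ _++_ 𝟎ₑ 𝟎ₑ x P Q ⟨
  (𝟎ₑ [ x ]≔ P) ⊎ₑ (𝟎ₑ [ x ]≔ Q)      ∎
  where open ≡-Reasoning

infix 4 _⊢_∶_[size_]
_⊢_∶_[size_] : Env n → Term n → Pos → ℕ → Set
Γ ⊢ t ∶ P [size s ] = Σ (Γ ⊢ t ∶ P) λ π → size π ≡ s

conv-sized : ∀ {Γ Γ' : Env n} {t P P' s} → Γ ≈E Γ' → P ≈P P' →
  Γ ⊢ t ∶ P [size s ] → Γ' ⊢ t ∶ P' [size s ]
conv-sized Γ≈Γ' P≈P' (π , size≡) = conv Γ≈Γ' P≈P' π , size≡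

resize : ∀ {Γ : Env n} {t P s s'} → s ≡ s' → Γ ⊢ t ∶ P [size s ] → Γ ⊢ t ∶ P [size s' ]
resize s≡s' (π , size≡) = π , trans size≡ s≡s'

app-sized : ∀ {Γ Γ' : Env n} {t u P Q s₁ s₂} →
  Γ ⊢ t ∶ ((P ⊸ Q) ∷ []) [size s₁ ] → Γ' ⊢ u ∶ P [size s₂ ] → (Γ ⊎ₑ Γ') ⊢ t · u ∶ Q [size suc (s₁ + s₂) ]
app-sized (π₁ , refl) (π₂ , refl) = app π₁ π₂ , refl

var-inv : ∀ {Γ : Env n} {x P} (π : Γ ⊢ var x ∶ P) → Γ ≈E (𝟎ₑ [ x ]≔ P) × size π ≡ 0
var-inv (ax x P) = Env≈.refl , refl
var-inv {x = x} (conv Γ'≈Γ P'≈P π) with var-inv π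
... | Γ'≈ , size≡ = Env≈.trans (Env≈.sym Γ'≈Γ) (Env≈.trans Γ'≈ (singleton-cong x P'≈P)) , size≡

record AppInversion (Γ : Env n) (t u : Term n) (Q : Pos) (s : ℕ) : Set where
  constructor app-inversion
  field
    {Γ₁ Γ₂} : Env n
    {P Q'}  : Pos
    fun     : Γ₁ ⊢ t ∶ ((P ⊸ Q') ∷ [])
    arg     : Γ₂ ⊢ u ∶ P
    Γ≈      : Γ ≈E (Γ₁ ⊎ₑ Γ₂)
    Q'≈Q    : Q' ≈P Q
    size≡   : s ≡ suc (size fun + size arg)

app-inv : ∀ {Γ : Env n} {t u Q} (π : Γ ⊢ t · u ∶ Q) → AppInversion Γ t u Q (size π)
app-inv (app π₁ π₂) = app-inversion π₁ π₂ Env≈.refl Pos≈.refl refl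
app-inv (conv Γ'≈Γ Q≈Q' π) with app-inv π
... | app-inversion π₁ π₂ Γ≈ Q≈ size≡ =
  app-inversion π₁ π₂ (Env≈.trans (Env≈.sym Γ'≈Γ) Γ≈) (Pos≈.trans Q≈ Q≈Q') size≡

-- LamPremises fixes its environment as a syntactic sum, so under conv a
-- λ-derivation can only be inverted to premises up to ≈E.
record Premises≈ (Γ : Env n) (t : Term (suc n)) (Ps : Pos) (s : ℕ) : Set where
  constructor premises≈
  field
    {Γ'}     : Env n
    Γ≈Γ'     : Γ ≈E Γ'
    premises : LamPremises Γ' t Ps
    size≡    : sizeL premises ≡ s

cons≈ : ∀ {Γ Δ : Env n} {t P Q N Ps s} → (P ⊸ Q) ≈N N → (π : (P ∷ Γ) ⊢ t ∶ Q) →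
  Premises≈ Δ t Ps s → Premises≈ (Γ ⊎ₑ Δ) t (N ∷ Ps) (size π + s)
cons≈ (⊸-cong P≈ Q≈) π (premises≈ Δ≈ ps size≡) =
  premises≈ (Env≈.∙-congˡ Δ≈) (conv (P≈ ∷ Env≈.refl) Q≈ π ∷ ps) (cong (size π +_) size≡)

permute-premises : ∀ {Γ : Env n} {t Ps Ps'} (ps : LamPremises Γ t Ps) → Ps ≈P Ps' →
  Premises≈ Γ t Ps' (sizeL ps)
permute-premises ps (Perm.refl Ps≋Ps') = pointwise ps Ps≋Ps'
  where
  pointwise : ∀ {Γ : Env _} {t Ps Ps'} (ps : LamPremises Γ t Ps) →
    ListPointwise.Pointwise _≈N_ Ps Ps' → Premises≈ Γ t Ps' (sizeL ps)
  pointwise []       []            = premises≈ Env≈.refl [] refl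
  pointwise (π ∷ ps) (N≈ ∷ Ps≋Ps') = cons≈ N≈ π (pointwise ps Ps≋Ps')
permute-premises (π ∷ ps) (Perm.prep N≈ p) = cons≈ N≈ π (permute-premises ps p)
permute-premises (_∷_ {Γ = Γ₁} π₁ (_∷_ {Γ = Γ₂} {Δ} π₂ ps)) (Perm.swap N₁≈ N₂≈ p)
  with cons≈ N₂≈ π₂ (cons≈ N₁≈ π₁ (permute-premises ps p))
... | premises≈ Γ≈ ps' size≡ =
  premises≈ (Env≈.trans (Env≈.x∙yz≈y∙xz Γ₁ Γ₂ Δ) Γ≈) ps'
            (trans size≡ (ℕ+.x∙yz≈y∙xz (size π₂) (size π₁) (sizeL ps)))
permute-premises ps (Perm.trans p q) with permute-premises ps p
... | premises≈ Γ≈ ps' size≡ with permute-premises ps' q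
... | premises≈ Γ≈' ps'' size≡' = premises≈ (Env≈.trans Γ≈ Γ≈') ps'' (trans size≡' size≡)

lam-inv : ∀ {Γ : Env n} {t P} (π : Γ ⊢ ƛ t ∶ P) → Premises≈ Γ t P (size π)
lam-inv (lam ps) = premises≈ Env≈.refl ps refl
lam-inv (conv Γ'≈Γ P'≈P π) with lam-inv π
... | premises≈ Γ'≈ ps size≡ with permute-premises ps P'≈P
... | premises≈ Γ≈ ps' size≡' =
  premises≈ (Env≈.trans (Env≈.sym Γ'≈Γ) (Env≈.trans Γ'≈ Γ≈)) ps' (trans size≡' size≡)

ƛ-inv : ∀ {Γ : Env n} {t P Q} (π : Γ ⊢ ƛ t ∶ ((P ⊸ Q) ∷ [])) → (P ∷ Γ) ⊢ t ∶ Q [size size π ]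
ƛ-inv π with lam-inv π
... | premises≈ Γ≈ (ρ ∷ []) size≡ =
  conv (Pos≈.refl ∷ Env≈.sym (Env≈.trans Γ≈ (Env≈.identityʳ _))) Pos≈.refl ρ
  , trans (sym (+-identityʳ (size ρ))) size≡

ƛ-intro : ∀ {Γ : Env n} {t P Q s} → (P ∷ Γ) ⊢ t ∶ Q [size s ] → Γ ⊢ ƛ t ∶ ((P ⊸ Q) ∷ []) [size s ]
ƛ-intro (ρ , refl) = conv (Env≈.identityʳ _) Pos≈.refl (lam (ρ ∷ [])) , +-identityʳ (size ρ)

ƛ-cons : ∀ {Γ Δ : Env n} {t P Q Ps s₁ s₂} → (P ∷ Γ) ⊢ t ∶ Q [size s₁ ] → Δ ⊢ ƛ t ∶ Ps [size s₂ ] →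
  (Γ ⊎ₑ Δ) ⊢ ƛ t ∶ (P ⊸ Q) ∷ Ps [size s₁ + s₂ ]
ƛ-cons (π , refl) (ρ , refl) with lam-inv ρ
... | premises≈ Δ≈ ps size≡ =
  conv (Env≈.∙-congˡ (Env≈.sym Δ≈)) Pos≈.refl (lam (π ∷ ps)) , cong (size π +_) size≡

record Split (Δ : Env n) (v : Term n) (P₁ P₂ : Pos) (s : ℕ) : Set where
  constructor split
  field
    {Δ₁ Δ₂} : Env n
    {s₁ s₂} : ℕ
    left    : Δ₁ ⊢ v ∶ P₁ [size s₁ ]
    right   : Δ₂ ⊢ v ∶ P₂ [size s₂ ]
    Δ≈      : Δ ≈E (Δ₁ ⊎ₑ Δ₂)
    size≡   : s ≡ s₁ + s₂

split-premises : ∀ {Γ : Env n} {t} P₁ {P₂} (ps : LamPremises Γ t (P₁ ++ P₂)) →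
  Split Γ (ƛ t) P₁ P₂ (sizeL ps)
split-premises []        ps = split (lam [] , refl) (lam ps , refl) (Env≈.sym (Env≈.identityˡ _)) refl
split-premises (_ ∷ P₁) (_∷_ {Γ = Γ} π ps) with split-premises P₁ ps
... | split {Δ₁ = Δ₁} {Δ₂} {s₁} {s₂} left right Δ≈ size≡ =
  split (ƛ-cons (π , refl) left) right
        (Env≈.trans (Env≈.∙-congˡ Δ≈) (Env≈.sym (Env≈.assoc Γ Δ₁ Δ₂)))
        (trans (cong (size π +_) size≡) (sym (+-assoc (size π) s₁ s₂)))

value-split : ∀ {Δ : Env n} {v} P₁ {P₂} → Value v → (ρ : Δ ⊢ v ∶ (P₁ ++ P₂)) → Split Δ v P₁ P₂ (size ρ)
value-split P₁ {P₂} (v-var x) ρ with var-inv ρ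
... | Δ≈ , size≡ =
  split (ax x P₁ , refl) (ax x P₂ , refl) (Env≈.trans Δ≈ (Env≈.reflexive (singleton-++ x P₁ P₂))) size≡
value-split P₁ (v-lam t) ρ with lam-inv ρ
... | premises≈ Δ≈ ps size≡ with split-premises P₁ ps
... | split left right Δ'≈ size≡' = split left right (Env≈.trans Δ≈ Δ'≈) (trans (sym size≡) size≡')

value-empty : ∀ {Δ : Env n} {v} → Value v → (ρ : Δ ⊢ v ∶ 𝟎) → Δ ≈E 𝟎ₑ × size ρ ≡ 0
value-empty (v-var x) ρ with var-inv ρ
... | Δ≈ , size≡ = Env≈.trans Δ≈ (Env≈.reflexive (replicate-[]≔ x [])) , size≡
value-empty (v-lam t) ρ with lam-inv ρ
... | premises≈ Δ≈ [] size≡ = Δ≈ , sym size≡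

shift-value : ∀ {v : Term n} → Value v → Value (shift v)
shift-value (v-var x) = v-var (suc x)
shift-value (v-lam t) = v-lam _

ext-punchIn : ∀ {k : Fin (suc n)} {ρ} → ρ ≗ punchIn k → ext ρ ≗ punchIn (suc k)
ext-punchIn ρ≗ zero    = refl
ext-punchIn ρ≗ (suc x) = cong suc (ρ≗ x)

mutual
  weaken : ∀ {Γ : Env n} {t P} {k ρ} → ρ ≗ punchIn k → (π : Γ ⊢ t ∶ P) →
    insertAt Γ k [] ⊢ rename ρ t ∶ P [size size π ]
  weaken {k = k} {ρ} ρ≗ (ax x P) = conv (Env≈.reflexive singleton≡) Pos≈.refl (ax (ρ x) P) , refl
    where
    open ≡-Reasoning
    singleton≡ : 𝟎ₑ [ ρ x ]≔ P ≡ insertAt (𝟎ₑ [ x ]≔ P) k []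
    singleton≡ = begin
      𝟎ₑ [ ρ x ]≔ P                      ≡⟨ cong (𝟎ₑ [_]≔ P) (ρ≗ x) ⟩
      𝟎ₑ [ punchIn k x ]≔ P              ≡⟨ cong (_[ punchIn k x ]≔ P) (insertAt-replicate k []) ⟨
      insertAt 𝟎ₑ k [] [ punchIn k x ]≔ P ≡⟨ insertAt-[]≔ 𝟎ₑ k x [] P ⟨
      insertAt (𝟎ₑ [ x ]≔ P) k []        ∎
  weaken {k = k} ρ≗ (app {Γ = Γ} {Γ'} π₁ π₂) =
    conv-sized (Env≈.reflexive (zipWith-insertAt _++_ Γ Γ' k [] [])) Pos≈.refl
               (app-sized (weaken ρ≗ π₁) (weaken ρ≗ π₂))
  weaken ρ≗ (lam ps) = weaken-premises ρ≗ ps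
  weaken {k = k} ρ≗ (conv Γ≈ P≈ π) = conv-sized (insertAt⁺ k Pos≈.refl Γ≈) P≈ (weaken ρ≗ π)

  weaken-premises : ∀ {Γ : Env n} {t Ps} {k ρ} → ρ ≗ punchIn k → (ps : LamPremises Γ t Ps) →
    insertAt Γ k [] ⊢ ƛ (rename (ext ρ) t) ∶ Ps [size sizeL ps ]
  weaken-premises {k = k} ρ≗ [] =
    conv (Env≈.reflexive (sym (insertAt-replicate k []))) Pos≈.refl (lam []) , refl
  weaken-premises {k = k} ρ≗ (_∷_ {Γ = Γ} {Δ} π ps) =
    conv-sized (Env≈.reflexive (zipWith-insertAt _++_ Γ Δ k [] [])) Pos≈.refl
               (ƛ-cons (weaken (ext-punchIn ρ≗) π) (weaken-premises ρ≗ ps))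

shift-typing : ∀ {Γ : Env n} {t P s} → Γ ⊢ t ∶ P [size s ] → ([] ∷ Γ) ⊢ shift t ∶ P [size s ]
shift-typing (π , refl) = weaken {k = zero} (λ _ → refl) π

record SubstitutesAt (σ : Fin (suc n) → Term n) (k : Fin (suc n)) (v : Term n) : Set where
  field
    at-k      : σ k ≡ v
    elsewhere : ∀ x (k≢x : k ≢ x) → σ x ≡ var (punchOut k≢x)

open SubstitutesAt

exts-substitutesAt : ∀ {σ : Fin (suc n) → Term n} {k v} →
  SubstitutesAt σ k v → SubstitutesAt (exts σ) (suc k) (shift v)
exts-substitutesAt σ-at .at-k = cong shift (at-k σ-at)
exts-substitutesAt σ-at .elsewhere zero    k≢x = refl
exts-substitutesAt σ-at .elsewhere (suc x) k≢x = cong shift (elsewhere σ-at x (λ k≡x → k≢x (cong suc k≡x)))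

[]-substitutesAt : (v : Term n) → SubstitutesAt (λ x → var x [ v ]) zero v
[]-substitutesAt v .at-k = refl
[]-substitutesAt v .elsewhere zero    k≢x = ⊥-elim (k≢x refl)
[]-substitutesAt v .elsewhere (suc x) k≢x = refl

removeAt-split : ∀ (Γ₁ Γ₂ : Env (suc n)) k {Δ Δ₁ Δ₂} → Δ ≈E (Δ₁ ⊎ₑ Δ₂) →
  ((removeAt Γ₁ k ⊎ₑ Δ₁) ⊎ₑ (removeAt Γ₂ k ⊎ₑ Δ₂)) ≈E (removeAt (Γ₁ ⊎ₑ Γ₂) k ⊎ₑ Δ)
removeAt-split Γ₁ Γ₂ k Δ≈ =
  Env≈.trans (Env≈.interchange _ _ _ _)
             (Env≈.∙-cong (Env≈.reflexive (sym (removeAt-zipWith _++_ Γ₁ Γ₂ k))) (Env≈.sym Δ≈))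

value-unused : ∀ {Γ Δ : Env n} {v P s} → Value v → Δ ⊢ v ∶ P [size s ] → P ≡ 𝟎 →
  Γ ≈E (Γ ⊎ₑ Δ) × s ≡ 0
value-unused val (ρ , refl) refl with value-empty val ρ
... | Δ≈ , size≡ = Env≈.trans (Env≈.sym (Env≈.identityʳ _)) (Env≈.∙-congˡ (Env≈.sym Δ≈)) , size≡

subst-ax : ∀ {Δ : Env n} {v σ s} k → SubstitutesAt σ k v → Value v → ∀ y P →
  Δ ⊢ v ∶ lookup (𝟎ₑ [ y ]≔ P) k [size s ] → (removeAt (𝟎ₑ [ y ]≔ P) k ⊎ₑ Δ) ⊢ σ y ∶ P [size s ]
subst-ax k σ-at val y P ρ with k ≟ y
... | yes refl rewrite at-k σ-at = conv-sized Δ≈ (Pos≈.reflexive (lookup∘update k 𝟎ₑ P)) ρ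
  where
  Δ≈ : _ ≈E (removeAt (𝟎ₑ [ k ]≔ P) k ⊎ₑ _)
  Δ≈ = Env≈.trans (Env≈.sym (Env≈.identityˡ _)) (Env≈.∙-congʳ (Env≈.reflexive (sym
         (trans (removeAt-[]≔-same 𝟎ₑ k P) (removeAt-replicate k [])))))
... | no k≢y rewrite elsewhere σ-at y k≢y
  with value-unused val ρ (trans (lookup∘update′ k≢y 𝟎ₑ P) (lookup-replicate k []))
... | Γ≈ , s≡0 = conv (Env≈.trans (Env≈.reflexive removed≡) Γ≈) Pos≈.refl (ax (punchOut k≢y) P) , sym s≡0
  where
  removed≡ : 𝟎ₑ [ punchOut k≢y ]≔ P ≡ removeAt (𝟎ₑ [ y ]≔ P) k
  removed≡ = sym (trans (removeAt-[]≔ 𝟎ₑ k≢y P) (cong (_[ punchOut k≢y ]≔ P) (removeAt-replicate k [])))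

mutual
  subst-typing : ∀ {Γ : Env (suc n)} {Δ t v Q σ s} k → SubstitutesAt σ k v → Value v →
    (π : Γ ⊢ t ∶ Q) → Δ ⊢ v ∶ lookup Γ k [size s ] →
    (removeAt Γ k ⊎ₑ Δ) ⊢ subst σ t ∶ Q [size size π + s ]
  subst-typing k σ-at val (ax y P) ρ = subst-ax k σ-at val y P ρ
  subst-typing k σ-at val (app {Γ = Γ₁} {Γ₂} π₁ π₂) (ρ , refl)
    with value-split (lookup Γ₁ k) val (conv Env≈.refl (Pos≈.reflexive (lookup-zipWith _++_ k Γ₁ Γ₂)) ρ)
  ... | split {s₁ = s₁} {s₂} ρ₁ ρ₂ Δ≈ size≡ =
    conv-sized (removeAt-split Γ₁ Γ₂ k Δ≈) Pos≈.refl
               (resize sizes≡ (app-sized (subst-typing k σ-at val π₁ ρ₁) (subst-typing k σ-at val π₂ ρ₂)))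
    where
    sizes≡ : suc ((size π₁ + s₁) + (size π₂ + s₂)) ≡ suc (size π₁ + size π₂) + size ρ
    sizes≡ = cong suc (trans (ℕ+.interchange (size π₁) s₁ (size π₂) s₂) (cong (size π₁ + size π₂ +_) (sym size≡)))
  subst-typing k σ-at val (lam ps) ρ = subst-premises k σ-at val ps ρ
  subst-typing k σ-at val (conv Γ≈ Q≈ π) ρ =
    conv-sized (Env≈.∙-congʳ (removeAt⁺ k Γ≈)) Q≈
               (subst-typing k σ-at val π (conv-sized Env≈.refl (Pos≈.sym (VecPointwise.lookup Γ≈ k)) ρ))

  subst-premises : ∀ {Γ : Env (suc n)} {Δ t v Ps σ s} k → SubstitutesAt σ k v → Value v →
    (ps : LamPremises Γ t Ps) → Δ ⊢ v ∶ lookup Γ k [size s ] →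
    (removeAt Γ k ⊎ₑ Δ) ⊢ ƛ (subst (exts σ) t) ∶ Ps [size sizeL ps + s ]
  subst-premises k σ-at val [] ρ with value-unused val ρ (lookup-replicate k [])
  ... | Γ≈ , s≡0 =
    conv (Env≈.trans (Env≈.reflexive (sym (removeAt-replicate k []))) Γ≈) Pos≈.refl (lam []) , sym s≡0
  subst-premises {σ = σ} k σ-at val (_∷_ {Γ = Γ₁} {Γ₂} {t} {P} {Q} π ps) (ρ , refl)
    with value-split (lookup Γ₁ k) val (conv Env≈.refl (Pos≈.reflexive (lookup-zipWith _++_ k Γ₁ Γ₂)) ρ)
  ... | split {Δ₁ = Δ₁} {s₁ = s₁} {s₂} ρ₁ ρ₂ Δ≈ size≡ =
    conv-sized (removeAt-split Γ₁ Γ₂ k Δ≈) Pos≈.refl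
               (resize sizes≡ (ƛ-cons body (subst-premises k σ-at val ps ρ₂)))
    where
    head≈ : (removeAt (P ∷ Γ₁) (suc k) ⊎ₑ ([] ∷ Δ₁)) ≈E (P ∷ (removeAt Γ₁ k ⊎ₑ Δ₁))
    head≈ = Env≈.trans (Env≈.reflexive (cong (_⊎ₑ _) (removeAt-suc P Γ₁ k))) (Pos≈.identityʳ P ∷ Env≈.refl)
    body : (P ∷ (removeAt Γ₁ k ⊎ₑ Δ₁)) ⊢ subst (exts σ) t ∶ Q [size size π + s₁ ]
    body = conv-sized head≈ Pos≈.refl
             (subst-typing (suc k) (exts-substitutesAt σ-at) (shift-value val) π (shift-typing ρ₁))
    sizes≡ : (size π + s₁) + (sizeL ps + s₂) ≡ (size π + sizeL ps) + size ρ
    sizes≡ = trans (ℕ+.interchange (size π) s₁ (sizeL ps) s₂) (cong (size π + sizeL ps +_) (sym size≡))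

[]-typing : ∀ {Γ Δ : Env n} {t v P Q s₁ s₂} → (P ∷ Γ) ⊢ t ∶ Q [size s₁ ] → Value v →
  Δ ⊢ v ∶ P [size s₂ ] → (Γ ⊎ₑ Δ) ⊢ t [ v ] ∶ Q [size s₁ + s₂ ]
[]-typing {v = v} (π , refl) val ρ = subst-typing zero ([]-substitutesAt v) val π ρ

ReducesSizeBy : (∀ {n} → Term n → Term n → Set) → ℕ → Set
ReducesSizeBy _↝_ d = ∀ {n} {Γ : Env n} {t t' P} → t ↝ t' → (π : Γ ⊢ t ∶ P) →
  Σ (Γ ⊢ t' ∶ P) λ π' → size π ≡ d + size π'

βv-reduces-size : ReducesSizeBy _↦βv_ 1
βv-reduces-size (βv t v val) π with app-inv π
... | app-inversion π₁ π₂ Γ≈ Q≈ size≡ with []-typing (ƛ-inv π₁) val (π₂ , refl)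
... | π' , size≡' = conv (Env≈.sym Γ≈) Q≈ π' , trans size≡ (cong suc (sym size≡'))

σ-reduces-size : ReducesSizeBy _↦σ_ 0
σ-reduces-size (σ₁ t u s) π with app-inv π
... | app-inversion {Γ₁ = Γa} {Γs} πa πs Γ≈ Q≈ size≡ with app-inv πa
... | app-inversion {Γ₁ = Γ₁} {Γ₂} πl πu Γa≈ Q'≈ size≡' with
  app-sized (ƛ-intro (conv-sized (Pos≈.identityʳ _ ∷ Env≈.refl) Pos≈.refl
                        (app-sized (conv-sized Env≈.refl Q'≈ (ƛ-inv πl)) (shift-typing (πs , refl)))))
            (πu , refl)
... | π' , size≡'' =
  conv (Env≈.sym (Env≈.trans Γ≈ (Env≈.trans (Env≈.∙-congʳ Γa≈) (Env≈.xy∙z≈xz∙y Γ₁ Γ₂ Γs)))) Q≈ π' ,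
  trans size≡ (trans (cong (λ a → suc (a + size πs)) size≡') (trans sizes≡ (sym size≡'')))
  where
  sizes≡ : suc (suc (size πl + size πu) + size πs) ≡ suc (suc (size πl + size πs) + size πu)
  sizes≡ = cong suc (ℕ+.xy∙z≈xz∙y (suc (size πl)) (size πu) (size πs))
σ-reduces-size (σ₃ v s u val) π with app-inv π
... | app-inversion {Γ₁ = Γv} {Γr} πv πr Γ≈ Q≈ size≡ with app-inv πr
... | app-inversion {Γ₁ = Γ₁} {Γ₂} πl πu Γr≈ R≈ size≡' with
  app-sized (ƛ-intro (app-sized (shift-typing (πv , refl)) (conv-sized Env≈.refl R≈ (ƛ-inv πl)))) (πu , refl)
... | π' , size≡'' =
  conv (Env≈.sym (Env≈.trans Γ≈ (Env≈.trans (Env≈.∙-congˡ Γr≈) (Env≈.sym (Env≈.assoc Γv Γ₁ Γ₂))))) Q≈ π' ,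
  trans size≡ (trans (cong (λ a → suc (size πv + a)) size≡') (trans sizes≡ (sym size≡'')))
  where
  sizes≡ : suc (size πv + suc (size πl + size πu)) ≡ suc (suc (size πv + size πl) + size πu)
  sizes≡ = cong suc (trans (+-suc (size πv) _) (cong suc (sym (+-assoc (size πv) (size πl) (size πu)))))

suc[[d+a]+b]≡d+suc[a+b] : ∀ d a b → suc ((d + a) + b) ≡ d + suc (a + b)
suc[[d+a]+b]≡d+suc[a+b] d a b = trans (cong suc (+-assoc d a b)) (sym (+-suc d (a + b)))

suc[a+[d+b]]≡d+suc[a+b] : ∀ d a b → suc (a + (d + b)) ≡ d + suc (a + b)
suc[a+[d+b]]≡d+suc[a+b] d a b = trans (cong suc (ℕ+.x∙yz≈y∙xz a d b)) (sym (+-suc d (a + b)))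

Bal-reduces-size : ∀ {_↝_ : ∀ {n} → Term n → Term n → Set} {d} →
  ReducesSizeBy _↝_ d → ReducesSizeBy (Bal _↝_) d
Bal-reduces-size root-reduces (root r) π = root-reduces r π
Bal-reduces-size {d = d} root-reduces (appL u st) π with app-inv π
... | app-inversion π₁ π₂ Γ≈ Q≈ size≡ with Bal-reduces-size root-reduces st π₁
... | π₁' , size≡' = conv (Env≈.sym Γ≈) Q≈ (app π₁' π₂) ,
  trans size≡ (trans (cong (λ a → suc (a + size π₂)) size≡') (suc[[d+a]+b]≡d+suc[a+b] d (size π₁') (size π₂)))
Bal-reduces-size {d = d} root-reduces (appR t st) π with app-inv π
... | app-inversion π₁ π₂ Γ≈ Q≈ size≡ with Bal-reduces-size root-reduces st π₂
... | π₂' , size≡' = conv (Env≈.sym Γ≈) Q≈ (app π₁ π₂') ,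
  trans size≡ (trans (cong (λ a → suc (size π₁ + a)) size≡') (suc[a+[d+b]]≡d+suc[a+b] d (size π₁) (size π₂')))
Bal-reduces-size {d = d} root-reduces (lamB u st) π with app-inv π
... | app-inversion π₁ π₂ Γ≈ Q≈ size≡ with ƛ-inv π₁
... | ρ , size≡ρ with Bal-reduces-size root-reduces st ρ
... | ρ' , size≡' with ƛ-intro (ρ' , refl)
... | π₁' , size≡₁ = conv (Env≈.sym Γ≈) Q≈ (app π₁' π₂) ,
  trans size≡ (trans (cong (λ a → suc (a + size π₂)) (trans (sym size≡ρ) (trans size≡' (cong (d +_) (sym size≡₁)))))
    (suc[[d+a]+b]≡d+suc[a+b] d (size π₁') (size π₂)))

subject-reduction : ∀ {Γ : Env n} {t s P j} → t →sh*[ j ] s → (π : Γ ⊢ t ∶ P) →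
  Σ (Γ ⊢ s ∶ P) λ π' → size π ≡ j + size π'
subject-reduction done π = π , refl
subject-reduction (moreβ st r) π with Bal-reduces-size βv-reduces-size st π
... | π₁ , size≡ with subject-reduction r π₁
... | π' , size≡' = π' , trans size≡ (cong suc size≡')
subject-reduction (moreσ st r) π with Bal-reduces-size σ-reduces-size st π
... | π₁ , size≡ with subject-reduction r π₁
... | π' , size≡' = π' , trans size≡ size≡'

value? : (t : Term n) → Dec (Value t)
value? (var x) = yes (v-var x)
value? (ƛ t)   = yes (v-lam t)
value? (t · u) = no λ ()

value-normal : ∀ {v : Term n} → Value v → ShNormal v
value-normal (v-var x) _ (stepβ (root ()))
value-normal (v-var x) _ (stepσ (root ()))
value-normal (v-lam t) _ (stepβ (root ()))
value-normal (v-lam t) _ (stepσ (root ()))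

normal-appˡ : ∀ {t u : Term n} → ShNormal (t · u) → ShNormal t
normal-appˡ {u = u} nf t' (stepβ st) = nf _ (stepβ (appL u st))
normal-appˡ {u = u} nf t' (stepσ st) = nf _ (stepσ (appL u st))

normal-appʳ : ∀ {t u : Term n} → ShNormal (t · u) → ShNormal u
normal-appʳ {t = t} nf u' (stepβ st) = nf _ (stepβ (appR t st))
normal-appʳ {t = t} nf u' (stepσ st) = nf _ (stepσ (appR t st))

++-≈𝟎 : ∀ P {Q} → (P ++ Q) ≈P 𝟎 → P ≈P 𝟎 × Q ≈P 𝟎
++-≈𝟎 []      Q≈𝟎 = Pos≈.refl , Q≈𝟎
++-≈𝟎 (N ∷ P) NP≈𝟎 = ⊥-elim (¬x∷xs↭[] NP≈𝟎)

⊎ₑ-≈𝟎 : ∀ (Γ Δ : Env n) → (Γ ⊎ₑ Δ) ≈E 𝟎ₑ → Γ ≈E 𝟎ₑ × Δ ≈E 𝟎ₑ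
⊎ₑ-≈𝟎 []      []      []            = [] , []
⊎ₑ-≈𝟎 (P ∷ Γ) (Q ∷ Δ) (PQ≈𝟎 ∷ ΓΔ≈𝟎) with ++-≈𝟎 P PQ≈𝟎 | ⊎ₑ-≈𝟎 Γ Δ ΓΔ≈𝟎
... | P≈𝟎 , Q≈𝟎 | Γ≈𝟎 , Δ≈𝟎 = P≈𝟎 ∷ Γ≈𝟎 , Q≈𝟎 ∷ Δ≈𝟎

normal-nonvalue-uses-env : ∀ {Γ : Env n} {s P} → ShNormal s → ¬ Value s → Γ ⊢ s ∶ P → ¬ Γ ≈E 𝟎ₑ
normal-nonvalue-uses-env {s = var x} nf ¬val π Γ≈𝟎 = ¬val (v-var x)
normal-nonvalue-uses-env {s = ƛ t}   nf ¬val π Γ≈𝟎 = ¬val (v-lam t)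
normal-nonvalue-uses-env {s = t · u} nf ¬val π Γ≈𝟎 with app-inv π
... | app-inversion {Γ₁ = Γ₁} {Γ₂} π₁ π₂ Γ≈ Q≈ size≡
  with ⊎ₑ-≈𝟎 Γ₁ Γ₂ (Env≈.trans (Env≈.sym Γ≈) Γ≈𝟎)
normal-nonvalue-uses-env {s = var x · u} nf ¬val π Γ≈𝟎 | app-inversion π₁ π₂ Γ≈ Q≈ size≡ | Γ₁≈𝟎 , _ =
  ¬x∷xs↭[] (Eq.subst₂ _≈P_ (lookup∘update x 𝟎ₑ _) (lookup-replicate x [])
    (VecPointwise.lookup (Env≈.trans (Env≈.sym (proj₁ (var-inv π₁))) Γ₁≈𝟎) x))
normal-nonvalue-uses-env {s = ƛ t · u} nf ¬val π Γ≈𝟎 | app-inversion π₁ π₂ Γ≈ Q≈ size≡ | _ , Γ₂≈𝟎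
  with value? u
... | yes val  = nf _ (stepβ (root (βv t u val)))
... | no ¬valu = normal-nonvalue-uses-env (normal-appʳ nf) ¬valu π₂ Γ₂≈𝟎
normal-nonvalue-uses-env {s = (t₁ · t₂) · u} nf ¬val π Γ≈𝟎 | app-inversion π₁ π₂ Γ≈ Q≈ size≡ | Γ₁≈𝟎 , _ =
  normal-nonvalue-uses-env (normal-appˡ nf) (λ ()) π₁ Γ₁≈𝟎

closed-normal-size : ∀ {s : Term n} → ShNormal s → (π : 𝟎ₑ ⊢ s ∶ 𝟎) → size π ≡ 0
closed-normal-size {s = s} nf π with value? s
... | yes val  = proj₂ (value-empty val π)
... | no ¬val  = ⊥-elim (normal-nonvalue-uses-env nf ¬val π Env≈.refl)

normalisation-βv-steps≡size : ∀ {t s : Term n} {j} (π : 𝟎ₑ ⊢ t ∶ 𝟎) → t →sh*[ j ] s → ShNormal s →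
  j ≡ size π
normalisation-βv-steps≡size {j = j} π r nf with subject-reduction r π
... | π' , size≡ = sym (trans size≡ (trans (cong (j +_) (closed-normal-size nf π')) (+-identityʳ j)))

count-βv-steps : ∀ {t s : Term n} → t →sh* s → ∃ λ k → t →sh*[ k ] s
count-βv-steps ε              = 0 , done
count-βv-steps (stepβ st ◅ r) with count-βv-steps r
... | k , r' = suc k , moreβ st r'
count-βv-steps (stepσ st ◅ r) with count-βv-steps r
... | k , r' = k , moreσ st r'

theorem5p6 : ∀ {n : ℕ} (t v : Term n) → Value v → t →sh* v →
    (π : 𝟎ₑ ⊢ t ∶ 𝟎) → LengβvIs t (size π)
theorem5p6 t v val t→*v π with count-βv-steps t→*v
... | k , t→*[k]v =
  (v , Eq.subst (t →sh*[_] v) (normalisation-βv-steps≡size π t→*[k]v v-normal) t→*[k]v , v-normal)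
  , λ s j t→*[j]s s-normal → normalisation-βv-steps≡size π t→*[j]s s-normal
  where
  v-normal : ShNormal v
  v-normal = value-normal val
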